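{- For every partition $\Sigma$ (of well-founded sets), the $\otimes$-graph $\mathcal{G}_\Sigma$ induced by $\Sigma$ is accessible.
   Context: Sets are elements of the von Neumann universe of well-founded sets. For sets $s,t$, $s\otimes t:=\{\{u,v\}: u\in s, v\in t\}$. A partition is a set of pairwise disjoint nonempty sets (blocks). For a set $S$, $\mathrm{Pow}^*_{1,2}(S):=\{t\subseteq\bigcup S : 1\le|t|\le 2,\ t\cap s\ne\emptyset \text{ for all } s\in S\}$, and $\mathrm{Pow}^*_{1,2}[\mathcal{B}]:=\{\mathrm{Pow}^*_{1,2}(X):X\in\mathcal{B}\}$. A subset $\Sigma^*\subseteq\Sigma$ is a $\otimes$-subpartition if $\bigcup\Sigma^*=\bigcup\mathrm{Pow}^*_{1,2}[\mathcal{B}]$ for some $\mathcal{B}\subseteq\Sigma\otimes\Sigma$; $\Sigma_\otimes$ is the $\subseteq$-largest $\otimes$-subpartition, and $\Pi_\otimes\subseteq\Sigma\otimes\Sigma$ is the (unique) set with $\bigcup\Sigma_\otimes=\bigcup\mathrm{Pow}^*_{1,2}[\Pi_\otimes]$. A $\otimes$-graph $\mathcal{G}=(\mathcal{P},\mathcal{N},\mathcal{T})$ has a set of places $\mathcal{P}$, nodes $\mathcal{N}=\mathcal{P}\otimes\mathcal{P}$ (nonempty subsets of $\mathcal{P}$ of size at most 2), $\mathcal{P}\cap\mathcal{N}=\emptyset$, and a target map $\mathcal{T}:\mathcal{N}\to\mathcal{P}(\mathcal{P})$. Source places are places in no $\mathcal{T}(B)$; accessible places form the least set containing the source places and containing $\mathcal{T}(B)$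 whenever all places of node $B$ are in it; $\mathcal{G}$ is accessible if all places are accessible. The $\otimes$-graph $\mathcal{G}_\Sigma=(\mathcal{P}_\Sigma,\mathcal{N}_\Sigma,\mathcal{T}_\Sigma)$ induced by $\Sigma$: choose a set $\mathcal{P}_\Sigma$ with $\mathcal{P}_\Sigma\cap(\mathcal{P}_\Sigma\otimes\mathcal{P}_\Sigma)=\emptyset$ and a bijection $q\mapsto q^{(\bullet)}$ from $\mathcal{P}_\Sigma$ onto $\Sigma$, extended to nodes by $B^{(\bullet)}:=\{q^{(\bullet)}:q\in B\}$; let $\mathcal{N}_\Sigma=\mathcal{P}_\Sigma\otimes\mathcal{P}_\Sigma$; for $B$ with $B^{(\bullet)}\in\Pi_\otimes$ let $\mathcal{T}_\Sigma(B)=\{q\in\mathcal{P}_\Sigma : q^{(\bullet)}\in\Sigma_\otimes,\ q^{(\bullet)}\cap\mathrm{Pow}^*_{1,2}(B^{(\bullet)})\ne\emptyset\}$, and $\mathcal{T}_\Sigma(B)=\emptyset$ otherwise. -}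

module Defs where

open import Level using (Level; 0ℓ) renaming (suc to lsuc)
open import Data.Bool using (Bool; true; false; if_then_else_)
open import Data.Product using (Σ; _×_; _,_)
open import Data.Sum using (_⊎_)
open import Relation.Nullary using (¬_)
open import Relation.Binary.PropositionalEquality using (_≡_)

-- Well-founded sets: Aczel's model of (constructive) set theory.
-- Every element of V is well-founded by construction.

data V : Set₁ where
  sup : (A : Set) → (A → V) → V

_≐_ : V → V → Set
sup A f ≐ sup B g =
  ((a : A) → Σ B λ b → f a ≐ g b) × ((b : B) → Σ A λ a → f a ≐ g b)

infix 4 _≐_ _∈_

_∈_ : V → V → Set
x ∈ sup A f = Σ A λ a → x ≐ f a

-- the set {a , b}  (equals {a} when a ≐ b)
pair : V → V → V
pair a b = sup Bool (λ i → if i then a else b)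

-- Subclasses (used for subsets of a given set) as extensional predicates

Extensional : (V → Set) → Set₁
Extensional S = ∀ x y → x ≐ y → S x → S y

InBigUnion : (V → Set) → V → Set₁
InBigUnion S z = Σ V λ s → S s × z ∈ s

InTensor : V → V → V → Set₁
InTensor s t X = Σ V λ u → Σ V λ v → u ∈ s × v ∈ t × X ≐ pair u v

InPow12 : V → V → Set₁
InPow12 S t =
  ((z : V) → z ∈ t → Σ V λ s → s ∈ S × z ∈ s)
  × (Σ V λ a → Σ V λ b → t ≐ pair a b)
  × ((s : V) → s ∈ S → Σ V λ z → z ∈ t × z ∈ s)

InUnionPow12 : (V → Set) → V → Set₁
InUnionPow12 B t = Σ V λ X → B X × InPow12 X t

IsPartition : V → Set₁
IsPartition Sg =
  ((b : V) → b ∈ Sg → Σ V λ z → z ∈ b)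
  × ((b c z : V) → b ∈ Sg → c ∈ Sg → z ∈ b → z ∈ c → b ≐ c)

UnionEq : V → (V → Set) → (V → Set) → Set₁
UnionEq Sg S B =
  Extensional B
  × ((X : V) → B X → InTensor Sg Sg X)
  × ((z : V) → (InBigUnion S z → InUnionPow12 B z) × (InUnionPow12 B z → InBigUnion S z))

IsTensorSubpartition : V → (V → Set) → Set₁
IsTensorSubpartition Sg S =
  Extensional S
  × ((x : V) → S x → x ∈ Sg)
  × (Σ (V → Set) λ B → UnionEq Sg S B)

IsLargestTensorSubpartition : V → (V → Set) → Set₁
IsLargestTensorSubpartition Sg S =
  IsTensorSubpartition Sg S
  × ((S' : V → Set) → IsTensorSubpartition Sg S' → (x : V) → S' x → S x)

IsPiTensor : V → (V → Set) → (V → Set) → Set₁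
IsPiTensor Sg S P = UnionEq Sg S P

-- ⊗-graphs.  A node {p , p'} (size 1 when p ≡ p') is represented by the
-- ordered pair (p , p'); T (p , p') q means q ∈ 𝒯({p , p'}).

record TensorGraph : Set₂ where
  field
    Place  : Set
    Target : Place × Place → Place → Set₁

module _ (G : TensorGraph) where
  open TensorGraph G

  IsSourcePlace : Place → Set₁
  IsSourcePlace q = (p p' : Place) → ¬ Target (p , p') q

  data AccessiblePlace : Place → Set₁ where
    source : (q : Place) → IsSourcePlace q → AccessiblePlace q
    fire   : (p p' q : Place) → AccessiblePlace p → AccessiblePlace p'
           → Target (p , p') q → AccessiblePlace q

  IsAccessible : Set₁
  IsAccessible = (q : Place) → AccessiblePlace q

-- The induced graph 𝒢_Σ.  Places: any set P with a bijection
-- e : P → Σ (q ↦ q^(•)), given as: into Σ, onto Σ, injective up to ≐.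

IsPlaceBijection : V → {P : Set} → (P → V) → Set₁
IsPlaceBijection Sg {P} e =
  ((q : P) → e q ∈ Sg)
  × ((b : V) → b ∈ Sg → Σ P λ q → e q ≐ b)
  × ((p q : P) → e p ≐ e q → p ≡ q)

inducedTarget : {P : Set} → (P → V) → (Sot Pot : V → Set) → P × P → P → Set₁
inducedTarget e Sot Pot (p , p') q =
  Pot (pair (e p) (e p'))
  × Sot (e q)
  × (Σ V λ t → t ∈ e q × InPow12 (pair (e p) (e p')) t)

inducedGraph : {P : Set} → (P → V) → (Sot Pot : V → Set) → TensorGraph
inducedGraph {P} e Sot Pot = record { Place = P ; Target = inducedTarget e Sot Pot }

module Submission where

open import Defs
open import Level using (0ℓ; Lift; lift) renaming (suc to lsuc)
open import Axiom.ExcludedMiddle using (ExcludedMiddle)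
open import Data.Bool using (Bool; true; false; if_then_else_)
open import Data.Product using (Σ; _×_; _,_; proj₁)
open import Relation.Nullary using (¬_; yes; no)

-- Every block q^(•) is nonempty; pick t ∈ q^(•) and induct on t.  If q^(•) ∉ Σ_⊗
-- then q is a source, as all targets lie in Σ_⊗.  Otherwise t ∈ ⋃ Pow*_{1,2}[Π_⊗],
-- so t ∈ Pow*_{1,2}({p^(•), p'^(•)}) for a node {p, p'} with q ∈ 𝒯({p, p'}), and t
-- meets p^(•) and p'^(•) in elements of t, to which the induction hypothesis applies.
-- Excluded middle only decides q^(•) ∈ Σ_⊗.

≐-refl : (x : V) → x ≐ x
≐-refl (sup A f) = (λ a → a , ≐-refl (f a)) , (λ a → a , ≐-refl (f a))

≐-sym : (x y : V) → x ≐ y → y ≐ x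
≐-sym (sup A f) (sup B g) (l , r) =
  (λ b → let (a , p) = r b in a , ≐-sym (f a) (g b) p) ,
  (λ a → let (b , p) = l a in b , ≐-sym (f a) (g b) p)

≐-trans : (x y z : V) → x ≐ y → y ≐ z → x ≐ z
≐-trans (sup A f) (sup B g) (sup C h) (l₁ , r₁) (l₂ , r₂) =
  (λ a → let (b , p) = l₁ a ; (c , q) = l₂ b in c , ≐-trans (f a) (g b) (h c) p q) ,
  (λ c → let (b , q) = r₂ c ; (a , p) = r₁ b in a , ≐-trans (f a) (g b) (h c) p q)

∈-resp-≐ˡ : (x y s : V) → x ≐ y → x ∈ s → y ∈ s
∈-resp-≐ˡ x y (sup A f) x≐y (a , x≐fa) = a , ≐-trans y x (f a) (≐-sym x y x≐y) x≐fa

∈-resp-≐ʳ : (x s t : V) → s ≐ t → x ∈ s → x ∈ t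
∈-resp-≐ʳ x (sup A f) (sup B g) (l , _) (a , x≐fa) =
  let (b , fa≐gb) = l a in b , ≐-trans x (f a) (g b) x≐fa fa≐gb

pair-cong : (a a' b b' : V) → a ≐ a' → b ≐ b' → pair a b ≐ pair a' b'
pair-cong a a' b b' a≐a' b≐b' = (λ i → i , componentwise i) , (λ i → i , componentwise i)
  where
  componentwise : (i : Bool) → (if i then a else b) ≐ (if i then a' else b')
  componentwise true  = a≐a'
  componentwise false = b≐b'

InPow12-resp-≐ : (X Y t : V) → X ≐ Y → InPow12 X t → InPow12 Y t
InPow12-resp-≐ X Y t X≐Y (t⊆⋃X , t-pair , t-meets) =
  (λ z z∈t → let (s , s∈X , z∈s) = t⊆⋃X z z∈t in s , ∈-resp-≐ʳ s X Y X≐Y s∈X , z∈s) ,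
  t-pair ,
  (λ s s∈Y → t-meets s (∈-resp-≐ʳ s Y X (≐-sym X Y X≐Y) s∈Y))

InPow12-meetsˡ : (x y t : V) → InPow12 (pair x y) t → Σ V λ z → z ∈ t × z ∈ x
InPow12-meetsˡ x y t (_ , _ , t-meets) = t-meets x (true , ≐-refl x)

InPow12-meetsʳ : (x y t : V) → InPow12 (pair x y) t → Σ V λ z → z ∈ t × z ∈ y
InPow12-meetsʳ x y t (_ , _ , t-meets) = t-meets y (false , ≐-refl y)

module InducedGraph
  (Sg : V) {P : Set} (e : P → V)
  (e-onto : (b : V) → b ∈ Sg → Σ P λ q → e q ≐ b)
  (Sot Pot : V → Set) (isΠ : IsPiTensor Sg Sot Pot)
  where

  G : TensorGraph
  G = inducedGraph e Sot Pot

  ¬Sot⇒source : (q : P) → ¬ Sot (e q) → IsSourcePlace G q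
  ¬Sot⇒source q q∉Sot p p' (_ , q∈Sot , _) = q∉Sot q∈Sot

  tensor⇒node : (X : V) → InTensor Sg Sg X → Σ P λ p → Σ P λ p' → X ≐ pair (e p) (e p')
  tensor⇒node X (u , v , u∈Sg , v∈Sg , X≐uv) =
    let (p , pu) = e-onto u u∈Sg
        (p' , pv) = e-onto v v∈Sg
    in p , p' , ≐-trans X (pair u v) (pair (e p) (e p')) X≐uv
                  (pair-cong u (e p) v (e p') (≐-sym (e p) u pu) (≐-sym (e p') v pv))

  Sot-member⇒coveringNode : (q : P) (t : V) → Sot (e q) → t ∈ e q →
    Σ P λ p → Σ P λ p' → Pot (pair (e p) (e p')) × InPow12 (pair (e p) (e p')) t
  Sot-member⇒coveringNode q t q∈Sot t∈q =
    let (Pot-resp-≐ , Pot⊆Sg⊗Sg , ⋃Sot≡⋃Pow12) = isΠ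
        (X , X∈Pot , t∈PowX) = proj₁ (⋃Sot≡⋃Pow12 t) (e q , q∈Sot , t∈q)
        (p , p' , X≐node) = tensor⇒node X (Pot⊆Sg⊗Sg X X∈Pot)
    in p , p' , Pot-resp-≐ X (pair (e p) (e p')) X≐node X∈Pot ,
       InPow12-resp-≐ X (pair (e p) (e p')) t X≐node t∈PowX

  member⇒accessible : ExcludedMiddle (lsuc 0ℓ) →
    (t : V) (q : P) → t ∈ e q → AccessiblePlace G q
  member⇒accessible em (sup A f) q t∈q with em {Lift (lsuc 0ℓ) (Sot (e q))}
  ... | no q∉Sot = source q (¬Sot⇒source q (λ q∈Sot → q∉Sot (lift q∈Sot)))
  ... | yes (lift q∈Sot) =
    let (p , p' , node∈Pot , t∈Pow) = Sot-member⇒coveringNode q t q∈Sot t∈q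
        (z , z∈t , z∈p) = InPow12-meetsˡ (e p) (e p') t t∈Pow
        (z' , z'∈t , z'∈p') = InPow12-meetsʳ (e p) (e p') t t∈Pow
    in fire p p' q (viaMember p z z∈t z∈p) (viaMember p' z' z'∈t z'∈p')
         (node∈Pot , q∈Sot , t , t∈q , t∈Pow)
    where
    t : V
    t = sup A f
    viaMember : (r : P) (z : V) → z ∈ t → z ∈ e r → AccessiblePlace G r
    viaMember r z (a , z≐fa) z∈r =
      member⇒accessible em (f a) r (∈-resp-≐ˡ z (f a) (e r) z≐fa z∈r)

lemma12 : ExcludedMiddle (lsuc 0ℓ)
    → (Sg : V) → IsPartition Sg
    → (P : Set) (e : P → V) → IsPlaceBijection Sg e
    → (Sot Pot : V → Set)
    → IsLargestTensorSubpartition Sg Sot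
    → IsPiTensor Sg Sot Pot
    → IsAccessible (inducedGraph e Sot Pot)
lemma12 em Sg (blocks-nonempty , _) P e (e∈Sg , e-onto , _) Sot Pot _ isΠ q =
  let (t , t∈q) = blocks-nonempty (e q) (e∈Sg q)
  in InducedGraph.member⇒accessible Sg e e-onto Sot Pot isΠ em t q t∈q
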